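{- For all graphs $G$ and $G'$, \[\operatorname{Z}^*(G)\,\operatorname{Z}^*(G')\le \operatorname{Z}^*(G\Box G'),\] and this bound is sharp, i.e., there exist graphs $G,G'$ for which equality holds.
   Context: All graphs are finite, simple and undirected with nonempty vertex sets. A fort of $G$ is a nonempty set $F\subseteq V(G)$ such that every $v\in V(G)\setminus F$ satisfies $|N_G(v)\cap F|\neq 1$; a minimal fort is a fort not properly containing another fort. The fractional zero forcing number is $\operatorname{Z}^*(G)=\min\{\sum_{v\in V(G)}x_v : \sum_{v\in F}x_v\ge 1 \text{ for every minimal fort } F \text{ of } G,\ x_v\ge 0\ \forall v\}$. The Cartesian product $G\Box G'$ has vertex set $V(G)\times V(G')$, with $(u,u')\sim(v,v')$ iff ($u=v$ and $u'v'\in E(G')$) or ($u'=v'$ and $uv\in E(G)$). -}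

module Defs where

open import Data.Nat using (ℕ; zero; suc; _≤_) renaming (_*_ to _*ℕ_)
open import Data.Fin using (Fin; remQuot)
open import Data.Fin.Properties using (_≟_)
open import Data.Bool using (Bool; true; false; _∧_; _∨_; if_then_else_)
open import Data.Product using (_×_; _,_; ∃; ∃-syntax; Σ)
open import Data.Rational using (ℚ; 0ℚ; 1ℚ) renaming (_+_ to _+ℚ_; _≤_ to _≤ℚ_)
open import Relation.Nullary using (¬_; does)
open import Relation.Binary.PropositionalEquality using (_≡_; _≢_)

record Graph : Set where
  constructor mkGraph
  field
    n   : ℕ
    adj : Fin n → Fin n → Bool
open Graph public

IsSimpleGraph : Graph → Set
IsSimpleGraph G =
  (1 ≤ n G) ×
  (∀ u v → adj G u v ≡ adj G v u) ×
  (∀ v → adj G v v ≡ false)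

-- Cartesian product G □ G' on Fin (n G * n G'); vertex k ↔ (u , u') = remQuot k.
_□_ : Graph → Graph → Graph
G □ G' = mkGraph (n G *ℕ n G') A
  where
  A : Fin (n G *ℕ n G') → Fin (n G *ℕ n G') → Bool
  A k l with remQuot {n G} (n G') k | remQuot {n G} (n G') l
  ... | (u , u') | (v , v') =
    (does (u ≟ v) ∧ adj G' u' v') ∨ (does (u' ≟ v') ∧ adj G u v)

Subset : ℕ → Set
Subset n = Fin n → Bool

_⊆_ : ∀ {n} → Subset n → Subset n → Set
F ⊆ F' = ∀ v → F v ≡ true → F' v ≡ true

count : ∀ n → Subset n → ℕ
count zero    S = 0
count (suc n) S = (if S Fin.zero then 1 else 0) Data.Nat.+ count n (λ i → S (Fin.suc i))
  where import Data.Nat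

sumℚ : ∀ n → (Fin n → ℚ) → ℚ
sumℚ zero    f = 0ℚ
sumℚ (suc n) f = f Fin.zero +ℚ sumℚ n (λ i → f (Fin.suc i))

nbrCount : (G : Graph) → Subset (n G) → Fin (n G) → ℕ
nbrCount G F v = count (n G) (λ u → adj G v u ∧ F u)

IsFort : (G : Graph) → Subset (n G) → Set
IsFort G F =
  (∃[ v ] F v ≡ true) ×
  (∀ v → F v ≡ false → nbrCount G F v ≢ 1)

IsMinimalFort : (G : Graph) → Subset (n G) → Set
IsMinimalFort G F =
  IsFort G F × (∀ F' → IsFort G F' → F' ⊆ F → F ⊆ F')

weightOf : (G : Graph) → (Fin (n G) → ℚ) → Subset (n G) → ℚ
weightOf G x F = sumℚ (n G) (λ v → if F v then x v else 0ℚ)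

total : (G : Graph) → (Fin (n G) → ℚ) → ℚ
total G x = sumℚ (n G) x

IsFeasible : (G : Graph) → (Fin (n G) → ℚ) → Set
IsFeasible G x =
  (∀ v → 0ℚ ≤ℚ x v) ×
  (∀ F → IsMinimalFort G F → 1ℚ ≤ℚ weightOf G x F)

IsZStar : Graph → ℚ → Set
IsZStar G z =
  (Σ (Fin (n G) → ℚ) λ x → IsFeasible G x × total G x ≡ z) ×
  (∀ x → IsFeasible G x → z ≤ℚ total G x)

{-# OPTIONS --safe #-}

-- Let x be an optimal vector for G □ G'. For a fort F of G and a fort F' of G', the product
-- F × F' is a fort of G □ G': a vertex (v, v') outside it has exactly
-- [v ∈ F] |N(v') ∩ F'| + [v' ∈ F'] |N(v) ∩ F| neighbours in it, and at most one of the
-- brackets is nonzero. Hence the column sums v' ↦ ∑_{v ∈ F} x(v, v') are feasible for G',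
-- so every fort F of G receives weight at least Z*(G') from the row sums
-- X(v) = ∑_{v'} x(v, v'). Thus X / Z*(G') is feasible for G, which gives
-- Z*(G) Z*(G') ≤ ∑ X = Z*(G □ G'). Only minimal forts constrain the LP, so we use that every
-- fort contains a minimal one; constructively this holds up to double negation, which suffices
-- because ≤ on ℚ is decidable. Equality holds for K₁ □ K₁ = K₁.
module Submission where

open import Defs
open import Data.Rational using (ℚ; _*_; _≤_)
open import Data.Product using (_×_; ∃-syntax)
open import Relation.Binary.PropositionalEquality using (_≡_)

open import Algebra.Bundles using (Monoid; CommutativeMonoid; Semiring; CommutativeRing)
open import Data.Bool using (Bool; true; false; _∧_; _∨_; if_then_else_)
open import Data.Bool.Properties using (∧-zeroʳ; ∧-comm; ∧-distribʳ-∨; ∧-commutativeMonoid)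
  renaming (_≟_ to _≟ᵇ_)
open import Data.Empty using (⊥-elim)
open import Data.Fin using (Fin; zero; suc; _↑ˡ_; _↑ʳ_; combine; remQuot; quotient; remainder; punchIn)
open import Data.Fin.Properties using (_≟_; all?; remQuot-combine; combine-remQuot; punchInᵢ≢i)
open import Data.Nat as ℕ using (ℕ; zero; suc)
import Data.Nat.Properties as ℕP
open import Data.Product using (_,_; proj₁; proj₂; uncurry)
open import Data.Rational using (0ℚ; 1ℚ; _+_; 1/_; positive; nonNegative)
import Data.Rational.Properties as ℚP
open import Data.Vec.Functional using (Vector; replicate)
open import Function using (_∘_; id)
open import Relation.Binary.Bundles using (Setoid)
open import Relation.Binary.Definitions using (tri<; tri≈; tri>)
open import Relation.Binary.PropositionalEquality
  using (refl; sym; trans; cong; cong₂; subst; _≢_; module ≡-Reasoning)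
open import Relation.Nullary using (¬_; Dec; yes; no; does; contradiction)
open import Relation.Nullary.Decidable using (_→-dec_; decidable-stable)
open import Algebra.Properties.CommutativeSemigroup (CommutativeMonoid.commutativeSemigroup ∧-commutativeMonoid)
  using () renaming (interchange to ∧-interchange)

module MonoidSum {a ℓ} (M : Monoid a ℓ) where
  open Monoid M using (Carrier; _≈_; _∙_; setoid; ∙-congˡ; assoc; identityˡ)
  open import Algebra.Properties.Monoid.Sum M
  open Setoid setoid using () renaming (refl to ≈-refl; sym to ≈-sym; trans to ≈-trans)

  sum-↑ : ∀ m {n} (f : Vector Carrier (m ℕ.+ n)) →
          sum f ≈ sum (f ∘ (_↑ˡ n)) ∙ sum (f ∘ (m ↑ʳ_))
  sum-↑ zero    f = ≈-sym (identityˡ _)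
  sum-↑ (suc m) f = ≈-trans (∙-congˡ (sum-↑ m (f ∘ suc))) (≈-sym (assoc _ _ _))

  sum-combine : ∀ m {n} (f : Vector Carrier (m ℕ.* n)) →
                sum f ≈ ∑[ i < m ] ∑[ j < n ] f (combine i j)
  sum-combine zero    f = ≈-refl
  sum-combine (suc m) {n} f = ≈-trans (sum-↑ n f) (∙-congˡ (sum-combine m (f ∘ (n ↑ʳ_))))

module CommutativeMonoidSum {a ℓ} (M : CommutativeMonoid a ℓ) where
  open CommutativeMonoid M using (Carrier; _≈_; _∙_; setoid; ∙-congˡ; identityʳ) renaming (ε to 0#)
  open import Algebra.Properties.CommutativeMonoid.Sum M
  open import Relation.Binary.Reasoning.Setoid setoid

  sum-supported-at : ∀ {n} (f : Vector Carrier n) i → (∀ j → j ≢ i → f j ≈ 0#) → sum f ≈ f i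
  sum-supported-at {suc n} f i f≈0 = begin
    sum f                        ≈⟨ sum-remove f ⟩
    f i ∙ sum (f ∘ punchIn i)    ≈⟨ ∙-congˡ (sum-cong-≋ (λ j → f≈0 (punchIn i j) (punchInᵢ≢i i j))) ⟩
    f i ∙ sum (replicate n 0#)   ≈⟨ ∙-congˡ (sum-replicate-zero n) ⟩
    f i ∙ 0#                     ≈⟨ identityʳ (f i) ⟩
    f i                          ∎

module SemiringSum {c ℓ} (R : Semiring c ℓ) where
  open Semiring R using (Carrier; _≈_; setoid) renaming (_*_ to _·_)
  open import Algebra.Properties.Semiring.Sum R
  open Setoid setoid using () renaming (sym to ≈-sym)
  open import Relation.Binary.Reasoning.Setoid setoid

  ∑-product : ∀ {m n} (f : Vector Carrier m) (g : Vector Carrier n) →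
              ∑[ i < m ] ∑[ j < n ] (f i · g j) ≈ sum f · sum g
  ∑-product f g = begin
    ∑[ i < _ ] ∑[ j < _ ] (f i · g j)  ≈⟨ sum-cong-≋ (λ i → ≈-sym (*-distribˡ-sum (f i) g)) ⟩
    ∑[ i < _ ] (f i · sum g)          ≈⟨ ≈-sym (*-distribʳ-sum (sum g) f) ⟩
    sum f · sum g                      ∎

module ℕΣ where
  open import Algebra.Properties.Semiring.Sum ℕP.+-*-semiring public
  open MonoidSum ℕP.+-0-monoid public
  open CommutativeMonoidSum ℕP.+-0-commutativeMonoid public
  open SemiringSum ℕP.+-*-semiring public

module ℚΣ where
  open import Algebra.Properties.Semiring.Sum (CommutativeRing.semiring ℚP.+-*-commutativeRing) public
  open MonoidSum ℚP.+-0-monoid public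

𝟙 : Bool → ℕ
𝟙 b = if b then 1 else 0

count≡sum : ∀ m (S : Subset m) → count m S ≡ ℕΣ.sum (𝟙 ∘ S)
count≡sum zero    S = refl
count≡sum (suc m) S = cong (𝟙 (S zero) ℕ.+_) (count≡sum m (S ∘ suc))

sumℚ≡sum : ∀ m (f : Vector ℚ m) → sumℚ m f ≡ ℚΣ.sum f
sumℚ≡sum zero    f = refl
sumℚ≡sum (suc m) f = cong (f zero +_) (sumℚ≡sum m (f ∘ suc))

sumℚ-mono-≤ : ∀ m {f g : Vector ℚ m} → (∀ i → f i ≤ g i) → sumℚ m f ≤ sumℚ m g
sumℚ-mono-≤ zero    f≤g = ℚP.≤-refl
sumℚ-mono-≤ (suc m) f≤g = ℚP.+-mono-≤ (f≤g zero) (sumℚ-mono-≤ m (f≤g ∘ suc))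

sumℚ-nonNeg : ∀ m {f : Vector ℚ m} → (∀ i → 0ℚ ≤ f i) → 0ℚ ≤ sumℚ m f
sumℚ-nonNeg zero    0≤f = ℚP.≤-refl
sumℚ-nonNeg (suc m) 0≤f = ℚP.+-mono-≤ (0≤f zero) (sumℚ-nonNeg m (0≤f ∘ suc))

-- weightOf G x full reduces to total G x.
full : ∀ {m} → Subset m
full _ = true

⊆-trans : ∀ {m} {A B C : Subset m} → A ⊆ B → B ⊆ C → A ⊆ C
⊆-trans A⊆B B⊆C v = B⊆C v ∘ A⊆B v

_⊆?_ : ∀ {m} (A B : Subset m) → Dec (A ⊆ B)
A ⊆? B = all? (λ v → (A v ≟ᵇ true) →-dec (B v ≟ᵇ true))

count-mono-⊆ : ∀ m {A B : Subset m} → A ⊆ B → count m A ℕ.≤ count m B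
count-mono-⊆ zero    A⊆B = ℕ.z≤n
count-mono-⊆ (suc m) {A} {B} A⊆B with A zero in A₀ | B zero in B₀
... | false | false = count-mono-⊆ m (A⊆B ∘ suc)
... | false | true  = ℕP.m≤n⇒m≤1+n (count-mono-⊆ m (A⊆B ∘ suc))
... | true  | false = contradiction (trans (sym (A⊆B zero A₀)) B₀) λ ()
... | true  | true  = ℕ.s≤s (count-mono-⊆ m (A⊆B ∘ suc))

⊆-cons : ∀ {m} {A B : Subset (suc m)} → (A zero ≡ true → B zero ≡ true) → (A ∘ suc) ⊆ (B ∘ suc) → A ⊆ B
⊆-cons A₀⊆B₀ A⊆B zero    = A₀⊆B₀
⊆-cons A₀⊆B₀ A⊆B (suc v) = A⊆B v

count-mono-⊂ : ∀ m {A B : Subset m} → A ⊆ B → ¬ B ⊆ A → count m A ℕ.< count m B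
count-mono-⊂ zero    A⊆B B⊈A = contradiction (λ ()) B⊈A
count-mono-⊂ (suc m) {A} {B} A⊆B B⊈A with A zero in A₀ | B zero in B₀
... | false | false = count-mono-⊂ m (A⊆B ∘ suc) (B⊈A ∘ ⊆-cons λ B₀≡true → contradiction (trans (sym B₀≡true) B₀) λ ())
... | false | true  = ℕ.s≤s (count-mono-⊆ m (A⊆B ∘ suc))
... | true  | false = contradiction (trans (sym (A⊆B zero A₀)) B₀) λ ()
... | true  | true  = ℕ.s≤s (count-mono-⊂ m (A⊆B ∘ suc) (B⊈A ∘ ⊆-cons λ _ → A₀))

module _ (G : Graph) where

  fort-⊇-minimalFort : ∀ {F} → IsFort G F → ¬ ¬ (∃[ F₀ ] IsMinimalFort G F₀ × F₀ ⊆ F)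
  fort-⊇-minimalFort {F} = below (suc (count (n G) F)) ℕP.≤-refl
    where
    below : ∀ bound {F} → count (n G) F ℕ.< bound → IsFort G F →
            ¬ ¬ (∃[ F₀ ] IsMinimalFort G F₀ × F₀ ⊆ F)
    below (suc bound) {F} (ℕ.s≤s |F|≤bound) fortF noMinimal =
      noMinimal (F , (fortF , minimal) , λ _ → id)
      where
      minimal : ∀ F' → IsFort G F' → F' ⊆ F → F ⊆ F'
      minimal F' fortF' F'⊆F with F ⊆? F'
      ... | yes F⊆F' = F⊆F'
      ... | no  F⊈F' = ⊥-elim (below bound
            (ℕP.<-≤-trans (count-mono-⊂ (n G) F'⊆F F⊈F') |F|≤bound) fortF'
            λ (F₀ , minF₀ , F₀⊆F') → noMinimal (F₀ , minF₀ , ⊆-trans F₀⊆F' F'⊆F))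

  mask : Vector ℚ (n G) → Subset (n G) → Vector ℚ (n G)
  mask x F v = if F v then x v else 0ℚ

  weightOf-mono-⊆ : ∀ {x} → (∀ v → 0ℚ ≤ x v) → ∀ {A B} → A ⊆ B → weightOf G x A ≤ weightOf G x B
  weightOf-mono-⊆ {x} 0≤x {A} {B} A⊆B = sumℚ-mono-≤ (n G) pointwise
    where
    pointwise : ∀ v → mask x A v ≤ mask x B v
    pointwise v with A v in Av | B v in Bv
    ... | true  | true  = ℚP.≤-refl
    ... | true  | false = contradiction (trans (sym (A⊆B v Av)) Bv) λ ()
    ... | false | true  = 0≤x v
    ... | false | false = ℚP.≤-refl

  isFeasible⇒fort-weight : ∀ {x} → IsFeasible G x → ∀ {F} → IsFort G F → 1ℚ ≤ weightOf G x F
  isFeasible⇒fort-weight {x} (0≤x , covers) {F} fortF =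
    decidable-stable (1ℚ ℚP.≤? weightOf G x F) λ 1≰wF →
      fort-⊇-minimalFort fortF λ (F₀ , minF₀ , F₀⊆F) →
        1≰wF (ℚP.≤-trans (covers F₀ minF₀) (weightOf-mono-⊆ 0≤x F₀⊆F))

  IsZStar⇒nonNeg : ∀ {z} → IsZStar G z → 0ℚ ≤ z
  IsZStar⇒nonNeg ((x , (0≤x , _) , total≡z) , _) = subst (0ℚ ≤_) total≡z (sumℚ-nonNeg (n G) 0≤x)

  weightOf-scale : ∀ c x F → weightOf G (λ v → c * x v) F ≡ c * weightOf G x F
  weightOf-scale c x F = begin
    weightOf G (λ v → c * x v) F         ≡⟨ sumℚ≡sum (n G) _ ⟩
    ℚΣ.sum (mask (λ v → c * x v) F)      ≡⟨ ℚΣ.sum-cong-≗ (λ v → mask-scale (F v)) ⟩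
    ℚΣ.sum (λ v → c * mask x F v)        ≡⟨ ℚΣ.*-distribˡ-sum c (mask x F) ⟨
    c * ℚΣ.sum (mask x F)                ≡⟨ cong (c *_) (sumℚ≡sum (n G) _) ⟨
    c * weightOf G x F                   ∎
    where
    open ≡-Reasoning
    mask-scale : ∀ {q} b → (if b then c * q else 0ℚ) ≡ c * (if b then q else 0ℚ)
    mask-scale true  = refl
    mask-scale false = sym (ℚP.*-zeroʳ c)

  IsZStar-*-≤-total : ∀ {z} → IsZStar G z → ∀ {c} X → (∀ v → 0ℚ ≤ X v) → 0ℚ ≤ c →
                      (∀ F → IsMinimalFort G F → c ≤ weightOf G X F) → z * c ≤ total G X
  IsZStar-*-≤-total {z} (_ , z-minimal) {c} X 0≤X 0≤c c≤wX with ℚP.<-cmp 0ℚ c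
  ... | tri> _ _ c<0  = contradiction (ℚP.≤-<-trans 0≤c c<0) (ℚP.<-irrefl refl)
  ... | tri≈ _ refl _ = subst (_≤ total G X) (sym (ℚP.*-zeroʳ z)) (sumℚ-nonNeg (n G) 0≤X)
  ... | tri< 0<c _ _  = begin
    z * c                       ≤⟨ ℚP.*-monoʳ-≤-nonNeg c (z-minimal X' X'-feasible) ⟩
    total G X' * c              ≡⟨ cong (_* c) (weightOf-scale (1/ c) X full) ⟩
    1/ c * total G X * c        ≡⟨ ℚP.*-assoc (1/ c) _ c ⟩
    1/ c * (total G X * c)      ≡⟨ cong (1/ c *_) (ℚP.*-comm _ c) ⟩
    1/ c * (c * total G X)      ≡⟨ ℚP.*-assoc (1/ c) c _ ⟨
    1/ c * c * total G X        ≡⟨ cong (_* total G X) (ℚP.*-inverseˡ c) ⟩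
    1ℚ * total G X              ≡⟨ ℚP.*-identityˡ _ ⟩
    total G X                   ∎
    where
    open ℚP.≤-Reasoning
    instance
      _ = positive 0<c
      _ = ℚP.pos⇒nonZero c
      _ = nonNegative 0≤c
      _ = ℚP.pos⇒nonNeg (1/ c) {{ℚP.1/pos⇒pos c}}
    X' : Vector ℚ (n G)
    X' v = 1/ c * X v
    X'-feasible : IsFeasible G X'
    X'-feasible = (λ v → subst (_≤ X' v) (ℚP.*-zeroʳ (1/ c)) (ℚP.*-monoˡ-≤-nonNeg (1/ c) (0≤X v)))
                , λ F minF → begin
                    1ℚ                     ≡⟨ ℚP.*-inverseˡ c ⟨
                    1/ c * c               ≤⟨ ℚP.*-monoˡ-≤-nonNeg (1/ c) (c≤wX F minF) ⟩
                    1/ c * weightOf G X F  ≡⟨ weightOf-scale (1/ c) X F ⟨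
                    weightOf G X' F        ∎

𝟙-∧ : ∀ a b → 𝟙 (a ∧ b) ≡ 𝟙 a ℕ.* 𝟙 b
𝟙-∧ true  b = sym (ℕP.+-identityʳ (𝟙 b))
𝟙-∧ false b = refl

𝟙-∨-disjoint : ∀ a b → a ∧ b ≡ false → 𝟙 (a ∨ b) ≡ 𝟙 a ℕ.+ 𝟙 b
𝟙-∨-disjoint true  true  ()
𝟙-∨-disjoint true  false _ = refl
𝟙-∨-disjoint false b     _ = refl

∑-𝟙-≟ : ∀ {m} (v : Fin m) b → ℕΣ.sum (λ u → 𝟙 (does (v ≟ u) ∧ b)) ≡ 𝟙 b
∑-𝟙-≟ v b = trans (ℕΣ.sum-supported-at _ v off-v) at-v
  where
  off-v : ∀ u → u ≢ v → 𝟙 (does (v ≟ u) ∧ b) ≡ 0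
  off-v u u≢v with v ≟ u
  ... | yes refl = contradiction refl u≢v
  ... | no  _    = refl
  at-v : 𝟙 (does (v ≟ v) ∧ b) ≡ 𝟙 b
  at-v with v ≟ v
  ... | yes _  = refl
  ... | no v≢v = contradiction refl v≢v

≟-∧-transport : ∀ {m} (P : Subset m) v u → does (v ≟ u) ∧ P u ≡ does (v ≟ u) ∧ P v
≟-∧-transport P v u with v ≟ u
... | yes refl = refl
... | no  _    = refl

if-∧ : ∀ a b (q : ℚ) → (if a ∧ b then q else 0ℚ) ≡ (if a then (if b then q else 0ℚ) else 0ℚ)
if-∧ true  b q = refl
if-∧ false b q = refl

sum-if : ∀ {m} b (g : Vector ℚ m) → ℚΣ.sum (λ i → if b then g i else 0ℚ) ≡ (if b then ℚΣ.sum g else 0ℚ)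
sum-if     true  g = refl
sum-if {m} false g = ℚΣ.sum-replicate-zero m

∑∑-if-∧ : ∀ {m k} (A : Subset m) (B : Subset k) (y : Fin m → Fin k → ℚ) →
          ℚΣ.sum (λ i → ℚΣ.sum (λ j → if A i ∧ B j then y i j else 0ℚ)) ≡
          sumℚ m (λ i → if A i then sumℚ k (λ j → if B j then y i j else 0ℚ) else 0ℚ)
∑∑-if-∧ {m} {k} A B y = begin
  ℚΣ.sum (λ i → ℚΣ.sum (λ j → if A i ∧ B j then y i j else 0ℚ))
    ≡⟨ ℚΣ.sum-cong-≗ (λ i → trans (ℚΣ.sum-cong-≗ λ j → if-∧ (A i) (B j) (y i j)) (sum-if (A i) λ j → if B j then y i j else 0ℚ)) ⟩
  ℚΣ.sum (λ i → if A i then ℚΣ.sum (λ j → if B j then y i j else 0ℚ) else 0ℚ)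
    ≡⟨ ℚΣ.sum-cong-≗ (λ i → cong (λ q → if A i then q else 0ℚ) (sumℚ≡sum k _)) ⟨
  ℚΣ.sum (λ i → if A i then sumℚ k (λ j → if B j then y i j else 0ℚ) else 0ℚ)
    ≡⟨ sumℚ≡sum m _ ⟨
  sumℚ m (λ i → if A i then sumℚ k (λ j → if B j then y i j else 0ℚ) else 0ℚ)  ∎
  where open ≡-Reasoning

module _ (G G' : Graph) where
  private
    vertexˡ : Fin (n G ℕ.* n G') → Fin (n G)
    vertexˡ = quotient (n G')
    vertexʳ : Fin (n G ℕ.* n G') → Fin (n G')
    vertexʳ = remainder {n G} (n G')

  _⊠_ : Subset (n G) → Subset (n G') → Subset (n (G □ G'))
  (F ⊠ F') k = F (vertexˡ k) ∧ F' (vertexʳ k)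

  ⊠-combine : ∀ F F' v v' → (F ⊠ F') (combine v v') ≡ F v ∧ F' v'
  ⊠-combine F F' v v' = cong (uncurry λ u u' → F u ∧ F' u') (remQuot-combine v v')

  adj-□ : ∀ k l → adj (G □ G') k l ≡
          (does (vertexˡ k ≟ vertexˡ l) ∧ adj G' (vertexʳ k) (vertexʳ l)) ∨
          (does (vertexʳ k ≟ vertexʳ l) ∧ adj G (vertexˡ k) (vertexˡ l))
  adj-□ k l with remQuot {n G} (n G') k | remQuot {n G} (n G') l
  ... | _ | _ = refl

  adj-□-combine : ∀ u u' v v' → adj (G □ G') (combine u u') (combine v v') ≡
                  (does (u ≟ v) ∧ adj G' u' v') ∨ (does (u' ≟ v') ∧ adj G u v)
  adj-□-combine u u' v v' = trans (adj-□ (combine u u') (combine v v'))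
    (cong₂ (λ (a , a') (b , b') → (does (a ≟ b) ∧ adj G' a' b') ∨ (does (a' ≟ b') ∧ adj G a b))
           (remQuot-combine u u') (remQuot-combine v v'))

  module _ {F : Subset (n G)} {F' : Subset (n G')} {v v'} (outside : F v ∧ F' v' ≡ false) where

    𝟙-adj-□-⊠ : ∀ u u' →
      𝟙 (adj (G □ G') (combine v v') (combine u u') ∧ (F ⊠ F') (combine u u')) ≡
      𝟙 (does (v ≟ u) ∧ F v) ℕ.* 𝟙 (adj G' v' u' ∧ F' u') ℕ.+
      𝟙 (does (v' ≟ u') ∧ F' v') ℕ.* 𝟙 (adj G v u ∧ F u)
    𝟙-adj-□-⊠ u u' = begin
      𝟙 (adj (G □ G') (combine v v') (combine u u') ∧ (F ⊠ F') (combine u u'))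
        ≡⟨ cong₂ (λ a b → 𝟙 (a ∧ b)) (adj-□-combine v v' u u') (⊠-combine F F' u u') ⟩
      𝟙 (((e ∧ a') ∨ (e' ∧ a)) ∧ (F u ∧ F' u'))
        ≡⟨ cong 𝟙 (regroup e e' a a' (F u) (F' u')) ⟩
      𝟙 ((e ∧ F u) ∧ (a' ∧ F' u') ∨ (e' ∧ F' u') ∧ (a ∧ F u))
        ≡⟨ cong₂ (λ x y → 𝟙 (x ∧ (a' ∧ F' u') ∨ y ∧ (a ∧ F u)))
                 (≟-∧-transport F v u) (≟-∧-transport F' v' u') ⟩
      𝟙 ((e ∧ F v) ∧ (a' ∧ F' u') ∨ (e' ∧ F' v') ∧ (a ∧ F u))
        ≡⟨ 𝟙-∨-disjoint ((e ∧ F v) ∧ (a' ∧ F' u')) ((e' ∧ F' v') ∧ (a ∧ F u)) disjoint ⟩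
      𝟙 ((e ∧ F v) ∧ (a' ∧ F' u')) ℕ.+ 𝟙 ((e' ∧ F' v') ∧ (a ∧ F u))
        ≡⟨ cong₂ ℕ._+_ (𝟙-∧ (e ∧ F v) (a' ∧ F' u')) (𝟙-∧ (e' ∧ F' v') (a ∧ F u)) ⟩
      𝟙 (e ∧ F v) ℕ.* 𝟙 (a' ∧ F' u') ℕ.+ 𝟙 (e' ∧ F' v') ℕ.* 𝟙 (a ∧ F u)   ∎
      where
      open ≡-Reasoning
      e  = does (v ≟ u)
      e' = does (v' ≟ u')
      a  = adj G v u
      a' = adj G' v' u'
      regroup : ∀ e e' a a' f f' → ((e ∧ a') ∨ (e' ∧ a)) ∧ (f ∧ f') ≡ (e ∧ f) ∧ (a' ∧ f') ∨ (e' ∧ f') ∧ (a ∧ f)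
      regroup e e' a a' f f' = trans (∧-distribʳ-∨ (f ∧ f') (e ∧ a') (e' ∧ a))
        (cong₂ _∨_ (∧-interchange e a' f f')
                   (trans (cong ((e' ∧ a) ∧_) (∧-comm f f')) (∧-interchange e' a f' f)))
      disjoint : ((e ∧ F v) ∧ (a' ∧ F' u')) ∧ ((e' ∧ F' v') ∧ (a ∧ F u)) ≡ false
      disjoint = begin
        ((e ∧ F v) ∧ (a' ∧ F' u')) ∧ ((e' ∧ F' v') ∧ (a ∧ F u))  ≡⟨ ∧-interchange (e ∧ F v) (a' ∧ F' u') (e' ∧ F' v') (a ∧ F u) ⟩
        ((e ∧ F v) ∧ (e' ∧ F' v')) ∧ rest                         ≡⟨ cong (_∧ rest) (∧-interchange e (F v) e' (F' v')) ⟩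
        ((e ∧ e') ∧ (F v ∧ F' v')) ∧ rest                         ≡⟨ cong (λ b → ((e ∧ e') ∧ b) ∧ rest) outside ⟩
        ((e ∧ e') ∧ false) ∧ rest                                 ≡⟨ cong (_∧ rest) (∧-zeroʳ (e ∧ e')) ⟩
        false                                                     ∎
        where rest = (a' ∧ F' u') ∧ (a ∧ F u)

    nbrCount-□-⊠ : nbrCount (G □ G') (F ⊠ F') (combine v v') ≡
                   𝟙 (F v) ℕ.* nbrCount G' F' v' ℕ.+ 𝟙 (F' v') ℕ.* nbrCount G F v
    nbrCount-□-⊠ = begin
      nbrCount (G □ G') (F ⊠ F') (combine v v')
        ≡⟨ count≡sum (n (G □ G')) _ ⟩
      sum (λ k → 𝟙 (adj (G □ G') (combine v v') k ∧ (F ⊠ F') k))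
        ≡⟨ sum-combine (n G) _ ⟩
      ∑[ u < n G ] ∑[ u' < n G' ] 𝟙 (adj (G □ G') (combine v v') (combine u u') ∧ (F ⊠ F') (combine u u'))
        ≡⟨ sum-cong-≗ (λ u → sum-cong-≗ (𝟙-adj-□-⊠ u)) ⟩
      ∑[ u < n G ] ∑[ u' < n G' ] (δ u ℕ.* row u' ℕ.+ δ' u' ℕ.* column u)
        ≡⟨ sum-cong-≗ (λ u → ∑-distrib-+ (λ u' → δ u ℕ.* row u') (λ u' → δ' u' ℕ.* column u)) ⟩
      ∑[ u < n G ] (∑[ u' < n G' ] (δ u ℕ.* row u') ℕ.+ ∑[ u' < n G' ] (δ' u' ℕ.* column u))
        ≡⟨ ∑-distrib-+ (λ u → ∑[ u' < n G' ] (δ u ℕ.* row u')) (λ u → ∑[ u' < n G' ] (δ' u' ℕ.* column u)) ⟩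
      ∑[ u < n G ] ∑[ u' < n G' ] (δ u ℕ.* row u') ℕ.+ ∑[ u < n G ] ∑[ u' < n G' ] (δ' u' ℕ.* column u)
        ≡⟨ cong₂ ℕ._+_ (∑-product δ row) (trans (∑-comm (λ u u' → δ' u' ℕ.* column u)) (∑-product δ' column)) ⟩
      sum δ ℕ.* sum row ℕ.+ sum δ' ℕ.* sum column
        ≡⟨ cong₂ ℕ._+_ (cong₂ ℕ._*_ (∑-𝟙-≟ v (F v)) (sym (count≡sum (n G') _)))
                       (cong₂ ℕ._*_ (∑-𝟙-≟ v' (F' v')) (sym (count≡sum (n G) _))) ⟩
      𝟙 (F v) ℕ.* nbrCount G' F' v' ℕ.+ 𝟙 (F' v') ℕ.* nbrCount G F v  ∎
      where
      open ≡-Reasoning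
      open ℕΣ
      δ : Vector ℕ (n G)
      δ u = 𝟙 (does (v ≟ u) ∧ F v)
      δ' : Vector ℕ (n G')
      δ' u' = 𝟙 (does (v' ≟ u') ∧ F' v')
      row : Vector ℕ (n G')
      row u' = 𝟙 (adj G' v' u' ∧ F' u')
      column : Vector ℕ (n G)
      column u = 𝟙 (adj G v u ∧ F u)

  ⊠-isFort : ∀ {F F'} → IsFort G F → IsFort G' F' → IsFort (G □ G') (F ⊠ F')
  ⊠-isFort {F} {F'} ((v , Fv) , F-fort) ((v' , F'v') , F'-fort) =
    (combine v v' , trans (⊠-combine F F' v v') (cong₂ _∧_ Fv F'v')) ,
    λ k → subst (λ k → (F ⊠ F') k ≡ false → nbrCount (G □ G') (F ⊠ F') k ≢ 1)
                (combine-remQuot {n G} (n G') k) (at-combine _ _)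
    where
    at-combine : ∀ u u' → (F ⊠ F') (combine u u') ≡ false →
                 nbrCount (G □ G') (F ⊠ F') (combine u u') ≢ 1
    at-combine u u' ∉F⊠F' with F u in Fu | F' u' in F'u'
                            | nbrCount-□-⊠ {F} {F'} {u} {u'} (trans (sym (⊠-combine F F' u u')) ∉F⊠F')
    ... | true  | true  | _  = contradiction (trans (sym (trans (⊠-combine F F' u u') (cong₂ _∧_ Fu F'u'))) ∉F⊠F') λ ()
    ... | true  | false | N≡ = λ N≡1 → F'-fort u' F'u'
                                 (trans (sym (trans (ℕP.+-identityʳ _) (ℕP.*-identityˡ _))) (trans (sym N≡) N≡1))
    ... | false | true  | N≡ = λ N≡1 → F-fort u Fu (trans (sym (ℕP.*-identityˡ _)) (trans (sym N≡) N≡1))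
    ... | false | false | N≡ = λ N≡1 → contradiction (trans (sym N≡) N≡1) λ ()

  module _ (x : Vector ℚ (n (G □ G'))) (F : Subset (n G)) (F' : Subset (n G')) where
    open ℚΣ using (sum-syntax; sum-combine; sum-cong-≗; ∑-comm)

    private
      weightOf-□-⊠-sum : weightOf (G □ G') x (F ⊠ F') ≡
                         ∑[ v < n G ] ∑[ v' < n G' ] (if F v ∧ F' v' then x (combine v v') else 0ℚ)
      weightOf-□-⊠-sum = trans (sumℚ≡sum (n (G □ G')) _) (trans (sum-combine (n G) _)
        (sum-cong-≗ λ v → sum-cong-≗ λ v' → cong (λ b → if b then x (combine v v') else 0ℚ) (⊠-combine F F' v v')))

    weightOf-□-⊠ʳ : weightOf (G □ G') x (F ⊠ F') ≡ weightOf G (λ v → weightOf G' (λ v' → x (combine v v')) F') F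
    weightOf-□-⊠ʳ = trans weightOf-□-⊠-sum (∑∑-if-∧ F F' (λ v v' → x (combine v v')))

    weightOf-□-⊠ˡ : weightOf (G □ G') x (F ⊠ F') ≡ weightOf G' (λ v' → weightOf G (λ v → x (combine v v')) F) F'
    weightOf-□-⊠ˡ = begin
      weightOf (G □ G') x (F ⊠ F')
        ≡⟨ weightOf-□-⊠-sum ⟩
      ∑[ v < n G ] ∑[ v' < n G' ] (if F v ∧ F' v' then x (combine v v') else 0ℚ)
        ≡⟨ ∑-comm (λ v v' → if F v ∧ F' v' then x (combine v v') else 0ℚ) ⟩
      ∑[ v' < n G' ] ∑[ v < n G ] (if F v ∧ F' v' then x (combine v v') else 0ℚ)
        ≡⟨ sum-cong-≗ (λ v' → sum-cong-≗ λ v → cong (λ b → if b then x (combine v v') else 0ℚ) (∧-comm (F v) (F' v'))) ⟩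
      ∑[ v' < n G' ] ∑[ v < n G ] (if F' v' ∧ F v then x (combine v v') else 0ℚ)
        ≡⟨ ∑∑-if-∧ F' F (λ v' v → x (combine v v')) ⟩
      weightOf G' (λ v' → weightOf G (λ v → x (combine v v')) F) F'  ∎
      where open ≡-Reasoning

  fibre-isFeasible : ∀ {x} → IsFeasible (G □ G') x → ∀ {F} → IsFort G F →
                     IsFeasible G' (λ v' → weightOf G (λ v → x (combine v v')) F)
  fibre-isFeasible {x} x-feasible {F} F-fort =
    (λ v' → sumℚ-nonNeg (n G) (λ v → masked-nonNeg (F v) (proj₁ x-feasible (combine v v')))) ,
    λ F' (F'-fort , _) → subst (1ℚ ≤_) (weightOf-□-⊠ˡ x F F')
      (isFeasible⇒fort-weight (G □ G') x-feasible (⊠-isFort F-fort F'-fort))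
    where
    masked-nonNeg : ∀ b {q} → 0ℚ ≤ q → 0ℚ ≤ (if b then q else 0ℚ)
    masked-nonNeg true  0≤q = 0≤q
    masked-nonNeg false _   = ℚP.≤-refl

  IsZStar-□-*-≤ : ∀ {z z' w} → IsZStar G z → IsZStar G' z' → IsZStar (G □ G') w → z * z' ≤ w
  IsZStar-□-*-≤ {z} {z'} zG zG' ((x , x-feasible , x-total) , _) =
    subst (z * z' ≤_) (trans (sym (weightOf-□-⊠ʳ x full full)) x-total)
      (IsZStar-*-≤-total G zG X (λ v → sumℚ-nonNeg (n G') (λ v' → proj₁ x-feasible (combine v v')))
                   (IsZStar⇒nonNeg G' zG') X-bound)
    where
    X : Vector ℚ (n G)
    X v = total G' (λ v' → x (combine v v'))
    X-bound : ∀ F → IsMinimalFort G F → z' ≤ weightOf G X F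
    X-bound F (F-fort , _) =
      subst (z' ≤_) (trans (sym (weightOf-□-⊠ˡ x F full)) (weightOf-□-⊠ʳ x F full))
            (proj₂ zG' _ (fibre-isFeasible x-feasible F-fort))

K₁ : Graph
K₁ = mkGraph 1 (λ _ _ → false)

K₁-isSimple : IsSimpleGraph K₁
K₁-isSimple = ℕ.s≤s ℕ.z≤n , (λ _ _ → refl) , (λ _ → refl)

IsZStar-one-vertex : (A : Fin 1 → Fin 1 → Bool) → IsZStar (mkGraph 1 A) 1ℚ
IsZStar-one-vertex A = ((λ _ → 1ℚ) , ((λ _ → ℚP.nonNegative⁻¹ 1ℚ) , covers) , refl) , minimal
  where
  covers : ∀ F → IsMinimalFort (mkGraph 1 A) F → 1ℚ ≤ weightOf (mkGraph 1 A) (λ _ → 1ℚ) F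
  covers F (((zero , F0) , _) , _) rewrite F0 = ℚP.≤-refl
  whole-isMinimalFort : IsMinimalFort (mkGraph 1 A) full
  whole-isMinimalFort = ((zero , refl) , λ _ ()) , λ { F' ((zero , F'0) , _) _ zero _ → F'0 }
  minimal : ∀ x → IsFeasible (mkGraph 1 A) x → 1ℚ ≤ total (mkGraph 1 A) x
  minimal x (_ , covers') = covers' _ whole-isMinimalFort

proposition4p16 :
    ((G G' : Graph) → IsSimpleGraph G → IsSimpleGraph G' →
      (z z' w : ℚ) → IsZStar G z → IsZStar G' z' → IsZStar (G □ G') w →
      z * z' ≤ w)
    ×
    (∃[ G ] ∃[ G' ] ∃[ z ] ∃[ z' ] ∃[ w ]
      (IsSimpleGraph G × IsSimpleGraph G' ×
       IsZStar G z × IsZStar G' z' × IsZStar (G □ G') w × z * z' ≡ w))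
proposition4p16 =
  (λ G G' _ _ _ _ _ → IsZStar-□-*-≤ G G') ,
  (K₁ , K₁ , 1ℚ , 1ℚ , 1ℚ , K₁-isSimple , K₁-isSimple ,
   IsZStar-one-vertex (adj K₁) , IsZStar-one-vertex (adj K₁) , IsZStar-one-vertex (adj (K₁ □ K₁)) , refl)
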